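{- Let $d\in\mathbb{N}$ and $D_E^{\mathrm{s}}=D_V^{\mathrm{s}}=\mathrm{Vect}(\mathbb{N}^{d+1})$. For $j\in\{0,\dots,d\}$ let $\partial^{(j)}$ be the endomorphism of $D_E^{\mathrm{s}}\otimes D_V^{\mathrm{s}}$ given on basis elements $a,b\in\mathbb{N}^{d+1}$ by $\partial^{(j)}(a\otimes b)=b_j\,(a-\epsilon^{(j)})\otimes(b-\epsilon^{(j)})$, with the convention that $c-\epsilon^{(j)}=0$ whenever $c_j=0$. Then for every $\lambda=(\lambda_0,\dots,\lambda_d)\in\mathbb{K}^{d+1}$, the map $\partial^\lambda=\sum_{i=0}^d\lambda_i\partial^{(i)}$ is tree-compatible.
   Context: $\mathbb{K}$ is a field of characteristic zero. Elements of $\mathbb{N}^{d+1}$ are written $a=(a_0,\dots,a_d)$; $\epsilon^{(j)}$ is the element with $\epsilon^{(j)}_i=\delta_{i,j}$. For vector spaces $D_E,D_V$ and a linear $\phi$ on $D_E\otimes D_V$, with $\tau$ the flip of $D_E\otimes D_E$, $\phi_{23}=\mathrm{Id}_{D_E}\otimes\phi$ and $\phi_{13}=(\tau\otimes\mathrm{Id}_{D_V})\circ(\mathrm{Id}_{D_E}\otimes\phi)\circ(\tau\otimes\mathrm{Id}_{D_V})$ on $D_E\otimes D_E\otimes D_V$; $\phi$ is tree-compatible if $\phi_{13}\circ\phi_{23}=\phi_{23}\circ\phi_{13}$. -}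

module Defs where

open import Level using (Level; _⊔_)
open import Algebra.Bundles using (CommutativeRing)
open import Data.Nat as ℕ using (ℕ; zero; suc)
open import Data.Fin using (Fin)
open import Data.Vec as V using (Vec; lookup; updateAt; allFin)
open import Data.List as L using (List; []; _∷_; _++_; concatMap)
open import Data.Product using (_×_; _,_; Σ; ∃)
open import Relation.Nullary using (¬_; Dec; yes; no)
open import Relation.Binary.PropositionalEquality using (_≡_)
open import Relation.Binary.Definitions using (DecidableEquality)
import Data.Vec.Properties as VP
import Data.Product.Properties as PP

record Field (c ℓ : Level) : Set (Level.suc (c ⊔ ℓ)) where
  field
    commutativeRing : CommutativeRing c ℓ
  open CommutativeRing commutativeRing public
  field
    0≉1     : ¬ (0# ≈ 1#)
    inverse : ∀ x → ¬ (x ≈ 0#) → Σ Carrier (λ y → (x * y) ≈ 1#)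

module _ {c ℓ} (K : Field c ℓ) where
  open Field K

  natK : ℕ → Carrier
  natK zero    = 0#
  natK (suc n) = 1# + natK n

CharacteristicZero : ∀ {c ℓ} → Field c ℓ → Set ℓ
CharacteristicZero K = ∀ n → ¬ (Field._≈_ K (natK K (suc n)) (Field.0# K))

-- Free vector space Vect(B) on a basis B with decidable equality:
-- formal finite linear combinations, compared via their coefficients.

module FreeVect {c ℓ} (K : Field c ℓ) where
  open Field K

  Vect : Set c → Set c
  Vect B = List (Carrier × B)

  coeff : {B : Set c} → DecidableEquality B → Vect B → B → Carrier
  coeff _≟_ []             b = 0#
  coeff _≟_ ((k , x) ∷ v)  b with x ≟ b
  ... | yes _ = k + coeff _≟_ v b
  ... | no  _ = coeff _≟_ v b

  VecEq : {B : Set c} → DecidableEquality B → Vect B → Vect B → Set (c ⊔ ℓ)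
  VecEq _≟_ v w = ∀ b → coeff _≟_ v b ≈ coeff _≟_ w b

  scale : {B : Set c} → Carrier → Vect B → Vect B
  scale k = L.map (λ { (k' , x) → (k * k' , x) })

  extend : {A B : Set c} → (A → Vect B) → Vect A → Vect B
  extend f = concatMap (λ { (k , x) → scale k (f x) })

  -- A linear map on D_E ⊗ D_V, with D_E = Vect(BE), D_V = Vect(BV),
  -- D_E ⊗ D_V = Vect(BE × BV), is given by its values on basis tensors.
  LinOnBasis : Set c → Set c → Set c
  LinOnBasis BE BV = (BE × BV) → Vect (BE × BV)

  module _ {BE BV : Set c} (φ : LinOnBasis BE BV) where
    φ₂₃ : (BE × BE × BV) → Vect (BE × BE × BV)
    φ₂₃ (a , a' , b) = L.map (λ { (k , (a'' , b'')) → (k , (a , a'' , b'')) }) (φ (a' , b))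

    -- φ₁₃ = (τ ⊗ Id) ∘ (Id ⊗ φ) ∘ (τ ⊗ Id)  on basis tensors a ⊗ a' ⊗ b
    φ₁₃ : (BE × BE × BV) → Vect (BE × BE × BV)
    φ₁₃ (a , a' , b) = L.map (λ { (k , (a'' , b'')) → (k , (a'' , a' , b'')) }) (φ (a , b))

  TreeCompatible : {BE BV : Set c} → DecidableEquality BE → DecidableEquality BV →
                   LinOnBasis BE BV → Set (c ⊔ ℓ)
  TreeCompatible {BE} {BV} _≟E_ _≟V_ φ =
    ∀ (v : Vect (BE × BE × BV)) →
      VecEq _≟3_ (extend (φ₁₃ φ) (extend (φ₂₃ φ) v))
                 (extend (φ₂₃ φ) (extend (φ₁₃ φ) v))
    where
      _≟3_ : DecidableEquality (BE × BE × BV)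
      _≟3_ = PP.≡-dec _≟E_ (PP.≡-dec _≟E_ _≟V_)

module Derivations {c ℓ} (K : Field c ℓ) (d : ℕ) where
  open Field K
  open FreeVect K

  Basis : Set c
  Basis = Level.Lift c (Vec ℕ (suc d))

  _≟B_ : DecidableEquality Basis
  Level.lift x ≟B Level.lift y with VP.≡-dec ℕ._≟_ x y
  ... | yes Relation.Binary.PropositionalEquality.refl = yes Relation.Binary.PropositionalEquality.refl
  ... | no ne = no (λ { Relation.Binary.PropositionalEquality.refl → ne Relation.Binary.PropositionalEquality.refl })

  -- c - ε^(j), assuming c_j ≠ 0
  minusε : Fin (suc d) → Vec ℕ (suc d) → Vec ℕ (suc d)
  minusε j x = updateAt x j ℕ.pred

  ∂ : Fin (suc d) → LinOnBasis Basis Basis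
  ∂ j (Level.lift a , Level.lift b) with lookup a j | lookup b j
  ... | zero  | _     = []
  ... | suc _ | zero  = []
  ... | suc _ | suc m = (natK K (suc m) , (Level.lift (minusε j a) , Level.lift (minusε j b))) ∷ []

  ∂λ : (Fin (suc d) → Carrier) → LinOnBasis Basis Basis
  ∂λ λs ab = concatMap (λ i → scale (λs i) (∂ i ab)) (V.toList (allFin (suc d)))

-- Pair formal combinations with test functions h : B → K.  Since coefficients
-- are pairings with indicator functions and pairing turns `extend f` into
-- precomposition with the transpose x ↦ ⟦ f x ⟧ h, tree-compatibility of φ
-- reduces to an identity between iterated pairings on basis tensors
-- a ⊗ a' ⊗ b.  That identity is bilinear in the two occurrences of φ, so for
-- ∂^λ it suffices that ∂^(i)₁₃ and ∂^(j)₂₃ commute for all i, j.  For i ≠ j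
-- they act on different coordinates; for i = j both composites have the
-- coefficient b_i (b_i − 1), nonzero only when a_i and a'_i are both positive.
module Submission where

open import Defs
open import Level using (Level; _⊔_; lift)
open import Data.Nat using (ℕ; zero; suc; pred)
open import Data.Fin using (Fin; _≟_)
open import Data.Vec using (Vec; lookup; toList; allFin)
open import Data.Vec.Properties using (lookup∘updateAt; lookup∘updateAt′; updateAt-commutes)
open import Data.List using (List; []; _∷_; _++_; map; concatMap)
open import Data.Product using (_×_; _,_; map₂)
open import Relation.Nullary using (Dec; yes; no)
open import Relation.Binary.Definitions using (DecidableEquality)
import Relation.Binary.PropositionalEquality as ≡
import Algebra.Properties.CommutativeSemigroup as CommutativeSemigroupProperties
import Relation.Binary.Reasoning.Setoid as SetoidReasoning

module Pairing {c ℓ} (K : Field c ℓ) where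
  open Field K
  open FreeVect K
  open SetoidReasoning setoid

  ⟦_⟧ : {B : Set c} → Vect B → (B → Carrier) → Carrier
  ⟦ []          ⟧ h = 0#
  ⟦ (k , x) ∷ v ⟧ h = k * h x + ⟦ v ⟧ h

  indicator : {A : Set c} → Dec A → Carrier
  indicator (yes _) = 1#
  indicator (no  _) = 0#

  coeff≈⟦⟧indicator : {B : Set c} (_≟B_ : DecidableEquality B) (v : Vect B) (y : B) →
                      coeff _≟B_ v y ≈ ⟦ v ⟧ (λ x → indicator (x ≟B y))
  coeff≈⟦⟧indicator _≟B_ []            y = refl
  coeff≈⟦⟧indicator _≟B_ ((k , x) ∷ v) y with x ≟B y
  ... | yes _ = +-cong (sym (*-identityʳ k)) (coeff≈⟦⟧indicator _≟B_ v y)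
  ... | no  _ = begin
    coeff _≟B_ v y    ≈⟨ coeff≈⟦⟧indicator _≟B_ v y ⟩
    ⟦ v ⟧ _          ≈⟨ +-identityˡ _ ⟨
    0# + ⟦ v ⟧ _     ≈⟨ +-congʳ (zeroʳ k) ⟨
    k * 0# + ⟦ v ⟧ _ ∎

  vecEq-from-⟦⟧ : {B : Set c} (_≟B_ : DecidableEquality B) {v w : Vect B} →
                  (∀ h → ⟦ v ⟧ h ≈ ⟦ w ⟧ h) → VecEq _≟B_ v w
  vecEq-from-⟦⟧ _≟B_ {v} {w} v≈w y = begin
    coeff _≟B_ v y  ≈⟨ coeff≈⟦⟧indicator _≟B_ v y ⟩
    ⟦ v ⟧ _        ≈⟨ v≈w _ ⟩
    ⟦ w ⟧ _        ≈⟨ coeff≈⟦⟧indicator _≟B_ w y ⟨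
    coeff _≟B_ w y  ∎

  ⟦⟧-cong : {B : Set c} (v : Vect B) {h h′ : B → Carrier} → (∀ x → h x ≈ h′ x) → ⟦ v ⟧ h ≈ ⟦ v ⟧ h′
  ⟦⟧-cong []            h≈h′ = refl
  ⟦⟧-cong ((k , x) ∷ v) h≈h′ = +-cong (*-congˡ (h≈h′ x)) (⟦⟧-cong v h≈h′)

  ⟦⟧-zero : {B : Set c} (v : Vect B) → ⟦ v ⟧ (λ _ → 0#) ≈ 0#
  ⟦⟧-zero []            = refl
  ⟦⟧-zero ((k , x) ∷ v) = trans (+-cong (zeroʳ k) (⟦⟧-zero v)) (+-identityˡ 0#)

  ⟦⟧-linear : {B : Set c} (v : Vect B) (a : Carrier) (f g : B → Carrier) →
              ⟦ v ⟧ (λ x → a * f x + g x) ≈ a * ⟦ v ⟧ f + ⟦ v ⟧ g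
  ⟦⟧-linear []            a f g = sym (trans (+-identityʳ _) (zeroʳ a))
  ⟦⟧-linear ((k , x) ∷ v) a f g = begin
    k * (a * f x + g x) + ⟦ v ⟧ _                      ≈⟨ +-cong (distribˡ k _ _) (⟦⟧-linear v a f g) ⟩
    (k * (a * f x) + k * g x) + (a * ⟦ v ⟧ f + ⟦ v ⟧ g) ≈⟨ +-congʳ (+-congʳ (x∙yz≈y∙xz k a (f x))) ⟩
    (a * (k * f x) + k * g x) + (a * ⟦ v ⟧ f + ⟦ v ⟧ g) ≈⟨ interchange _ _ _ _ ⟩
    (a * (k * f x) + a * ⟦ v ⟧ f) + (k * g x + ⟦ v ⟧ g) ≈⟨ +-congʳ (distribˡ a _ _) ⟨
    a * (k * f x + ⟦ v ⟧ f) + (k * g x + ⟦ v ⟧ g)       ∎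
    where
    open CommutativeSemigroupProperties *-commutativeSemigroup using (x∙yz≈y∙xz)
    open CommutativeSemigroupProperties +-commutativeSemigroup using (interchange)

  ⟦++⟧ : {B : Set c} (v w : Vect B) (h : B → Carrier) → ⟦ v ++ w ⟧ h ≈ ⟦ v ⟧ h + ⟦ w ⟧ h
  ⟦++⟧ []            w h = sym (+-identityˡ _)
  ⟦++⟧ ((k , x) ∷ v) w h = trans (+-congˡ (⟦++⟧ v w h)) (sym (+-assoc _ _ _))

  ⟦scale⟧ : {B : Set c} (a : Carrier) (v : Vect B) (h : B → Carrier) → ⟦ scale a v ⟧ h ≈ a * ⟦ v ⟧ h
  ⟦scale⟧ a []            h = sym (zeroʳ a)
  ⟦scale⟧ a ((k , x) ∷ v) h = begin
    (a * k) * h x + ⟦ scale a v ⟧ h ≈⟨ +-cong (*-assoc a k (h x)) (⟦scale⟧ a v h) ⟩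
    a * (k * h x) + a * ⟦ v ⟧ h     ≈⟨ distribˡ a _ _ ⟨
    a * (k * h x + ⟦ v ⟧ h)         ∎

  ⟦extend⟧ : {A B : Set c} (f : A → Vect B) (v : Vect A) (h : B → Carrier) →
             ⟦ extend f v ⟧ h ≈ ⟦ v ⟧ (λ x → ⟦ f x ⟧ h)
  ⟦extend⟧ f []            h = refl
  ⟦extend⟧ f ((k , x) ∷ v) h = begin
    ⟦ scale k (f x) ++ extend f v ⟧ h      ≈⟨ ⟦++⟧ (scale k (f x)) _ h ⟩
    ⟦ scale k (f x) ⟧ h + ⟦ extend f v ⟧ h ≈⟨ +-cong (⟦scale⟧ k (f x) h) (⟦extend⟧ f v h) ⟩
    k * ⟦ f x ⟧ h + ⟦ v ⟧ (λ x → ⟦ f x ⟧ h) ∎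

  ⟦map₂⟧ : {A B : Set c} (g : A → B) (v : Vect A) (h : B → Carrier) →
           ⟦ map (map₂ g) v ⟧ h ≈ ⟦ v ⟧ (λ x → h (g x))
  ⟦map₂⟧ g []            h = refl
  ⟦map₂⟧ g ((k , x) ∷ v) h = +-congˡ (⟦map₂⟧ g v h)

module TreeCompatibility {c ℓ} (K : Field c ℓ) {BE BV : Set c} where
  open Field K
  open FreeVect K
  open Pairing K
  open SetoidReasoning setoid

  Triple : Set c
  Triple = BE × BE × BV

  swap₁₂ : Triple → Triple
  swap₁₂ (a , a′ , b) = (a′ , a , b)

  ⟦_₁₃∘_₂₃⟧ : LinOnBasis BE BV → LinOnBasis BE BV → Triple → (Triple → Carrier) → Carrier
  ⟦ ψ ₁₃∘ χ ₂₃⟧ (a , a′ , b) h =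
    ⟦ χ (a′ , b) ⟧ (λ (a″ , b′) → ⟦ ψ (a , b′) ⟧ (λ (a‴ , b″) → h (a‴ , a″ , b″)))

  -- χ₂₃ ∘ ψ₁₃ is χ₁₃ ∘ ψ₂₃ conjugated by τ ⊗ Id, which gives the right-hand side.
  Commute₁₃₂₃ : LinOnBasis BE BV → LinOnBasis BE BV → Set (c ⊔ ℓ)
  Commute₁₃₂₃ ψ χ = ∀ x h → ⟦ ψ ₁₃∘ χ ₂₃⟧ x h ≈ ⟦ χ ₁₃∘ ψ ₂₃⟧ (swap₁₂ x) (λ y → h (swap₁₂ y))

  commute₁₃₂₃-sym : (ψ χ : LinOnBasis BE BV) → Commute₁₃₂₃ χ ψ → Commute₁₃₂₃ ψ χ
  commute₁₃₂₃-sym ψ χ χψ x h = sym (χψ (swap₁₂ x) (λ y → h (swap₁₂ y)))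

  ⟦φ₂₃⟧∘⟦φ₁₃⟧ : (ψ χ : LinOnBasis BE BV) (x : Triple) (h : Triple → Carrier) →
                ⟦ φ₂₃ χ x ⟧ (λ y → ⟦ φ₁₃ ψ y ⟧ h) ≈ ⟦ ψ ₁₃∘ χ ₂₃⟧ x h
  ⟦φ₂₃⟧∘⟦φ₁₃⟧ ψ χ (a , a′ , b) h = begin
    ⟦ φ₂₃ χ (a , a′ , b) ⟧ (λ y → ⟦ φ₁₃ ψ y ⟧ h)
      ≈⟨ ⟦map₂⟧ _ (χ (a′ , b)) _ ⟩
    ⟦ χ (a′ , b) ⟧ (λ (a″ , b′) → ⟦ φ₁₃ ψ (a , a″ , b′) ⟧ h)
      ≈⟨ ⟦⟧-cong (χ (a′ , b)) (λ (a″ , b′) → ⟦map₂⟧ _ (ψ (a , b′)) h) ⟩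
    ⟦ ψ ₁₃∘ χ ₂₃⟧ (a , a′ , b) h ∎

  ⟦φ₁₃⟧∘⟦φ₂₃⟧ : (ψ χ : LinOnBasis BE BV) (x : Triple) (h : Triple → Carrier) →
                ⟦ φ₁₃ ψ x ⟧ (λ y → ⟦ φ₂₃ χ y ⟧ h) ≈ ⟦ χ ₁₃∘ ψ ₂₃⟧ (swap₁₂ x) (λ y → h (swap₁₂ y))
  ⟦φ₁₃⟧∘⟦φ₂₃⟧ ψ χ (a , a′ , b) h = begin
    ⟦ φ₁₃ ψ (a , a′ , b) ⟧ (λ y → ⟦ φ₂₃ χ y ⟧ h)
      ≈⟨ ⟦map₂⟧ _ (ψ (a , b)) _ ⟩
    ⟦ ψ (a , b) ⟧ (λ (a″ , b′) → ⟦ φ₂₃ χ (a″ , a′ , b′) ⟧ h)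
      ≈⟨ ⟦⟧-cong (ψ (a , b)) (λ (a″ , b′) → ⟦map₂⟧ _ (χ (a′ , b′)) h) ⟩
    ⟦ χ ₁₃∘ ψ ₂₃⟧ (a′ , a , b) (λ y → h (swap₁₂ y)) ∎

  treeCompatible : (_≟E_ : DecidableEquality BE) (_≟V_ : DecidableEquality BV) {φ : LinOnBasis BE BV} →
                   Commute₁₃₂₃ φ φ → TreeCompatible _≟E_ _≟V_ φ
  treeCompatible _≟E_ _≟V_ {φ} φφ v =
    vecEq-from-⟦⟧ _ {extend (φ₁₃ φ) (extend (φ₂₃ φ) v)} {extend (φ₂₃ φ) (extend (φ₁₃ φ) v)} λ h → begin
    ⟦ extend (φ₁₃ φ) (extend (φ₂₃ φ) v) ⟧ h
      ≈⟨ ⟦extend⟧ (φ₁₃ φ) (extend (φ₂₃ φ) v) h ⟩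
    ⟦ extend (φ₂₃ φ) v ⟧ (λ y → ⟦ φ₁₃ φ y ⟧ h)
      ≈⟨ ⟦extend⟧ (φ₂₃ φ) v _ ⟩
    ⟦ v ⟧ (λ x → ⟦ φ₂₃ φ x ⟧ (λ y → ⟦ φ₁₃ φ y ⟧ h))
      ≈⟨ ⟦⟧-cong v (λ x → trans (⟦φ₂₃⟧∘⟦φ₁₃⟧ φ φ x h) (trans (φφ x h) (sym (⟦φ₁₃⟧∘⟦φ₂₃⟧ φ φ x h)))) ⟩
    ⟦ v ⟧ (λ x → ⟦ φ₁₃ φ x ⟧ (λ y → ⟦ φ₂₃ φ y ⟧ h))
      ≈⟨ ⟦extend⟧ (φ₁₃ φ) v _ ⟨
    ⟦ extend (φ₁₃ φ) v ⟧ (λ y → ⟦ φ₂₃ φ y ⟧ h)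
      ≈⟨ ⟦extend⟧ (φ₂₃ φ) (extend (φ₁₃ φ) v) h ⟨
    ⟦ extend (φ₂₃ φ) (extend (φ₁₃ φ) v) ⟧ h ∎

  linComb : {I : Set} → List I → (I → Carrier) → (I → LinOnBasis BE BV) → LinOnBasis BE BV
  linComb is λs ψ x = concatMap (λ i → scale (λs i) (ψ i x)) is

  ⟦linComb-∷⟧ : {I : Set} (i : I) (is : List I) (λs : I → Carrier) (ψ : I → LinOnBasis BE BV)
                (x : BE × BV) (h : BE × BV → Carrier) →
                ⟦ linComb (i ∷ is) λs ψ x ⟧ h ≈ λs i * ⟦ ψ i x ⟧ h + ⟦ linComb is λs ψ x ⟧ h
  ⟦linComb-∷⟧ i is λs ψ x h = trans (⟦++⟧ (scale (λs i) (ψ i x)) _ h) (+-congʳ (⟦scale⟧ (λs i) (ψ i x) h))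

  commute₁₃₂₃-linCombˡ : {I : Set} (is : List I) (λs : I → Carrier) (ψ : I → LinOnBasis BE BV)
                         (χ : LinOnBasis BE BV) → (∀ i → Commute₁₃₂₃ (ψ i) χ) →
                         Commute₁₃₂₃ (linComb is λs ψ) χ
  commute₁₃₂₃-linCombˡ []       λs ψ χ ψχ (a , a′ , b) h = ⟦⟧-zero (χ (a′ , b))
  commute₁₃₂₃-linCombˡ (i ∷ is) λs ψ χ ψχ x@(a , a′ , b) h = begin
    ⟦ ψΣ ₁₃∘ χ ₂₃⟧ x h
      ≈⟨ ⟦⟧-cong (χ (a′ , b)) (λ (a″ , b′) → ⟦linComb-∷⟧ i is λs ψ (a , b′) _) ⟩
    ⟦ χ (a′ , b) ⟧ (λ (a″ , b′) → λs i * ⟦ ψ i (a , b′) ⟧ (h₂ a″) + ⟦ linComb is λs ψ (a , b′) ⟧ (h₂ a″))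
      ≈⟨ ⟦⟧-linear (χ (a′ , b)) (λs i) _ _ ⟩
    λs i * ⟦ ψ i ₁₃∘ χ ₂₃⟧ x h + ⟦ linComb is λs ψ ₁₃∘ χ ₂₃⟧ x h
      ≈⟨ +-cong (*-congˡ (ψχ i x h)) (commute₁₃₂₃-linCombˡ is λs ψ χ ψχ x h) ⟩
    λs i * ⟦ χ ₁₃∘ ψ i ₂₃⟧ x′ h′ + ⟦ χ ₁₃∘ linComb is λs ψ ₂₃⟧ x′ h′
      ≈⟨ ⟦linComb-∷⟧ i is λs ψ (a , b) _ ⟨
    ⟦ χ ₁₃∘ ψΣ ₂₃⟧ x′ h′ ∎
    where
    ψΣ : LinOnBasis BE BV
    ψΣ = linComb (i ∷ is) λs ψ
    x′ : Triple
    x′ = swap₁₂ x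
    h′ : Triple → Carrier
    h′ y = h (swap₁₂ y)
    h₂ : BE → BE × BV → Carrier
    h₂ a″ (a‴ , b″) = h (a‴ , a″ , b″)

  commute₁₃₂₃-linCombʳ : {I : Set} (is : List I) (λs : I → Carrier) (ψ : LinOnBasis BE BV)
                         (χ : I → LinOnBasis BE BV) → (∀ i → Commute₁₃₂₃ ψ (χ i)) →
                         Commute₁₃₂₃ ψ (linComb is λs χ)
  commute₁₃₂₃-linCombʳ is λs ψ χ ψχ =
    commute₁₃₂₃-sym ψ (linComb is λs χ)
      (commute₁₃₂₃-linCombˡ is λs χ ψ (λ i → commute₁₃₂₃-sym (χ i) ψ (ψχ i)))

module DerivationsCommute {c ℓ} (K : Field c ℓ) (d : ℕ) where
  open Field K
  open FreeVect K
  open Pairing K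
  open Derivations K d
  open TreeCompatibility K {Basis} {Basis}
  open SetoidReasoning setoid
  open CommutativeSemigroupProperties *-commutativeSemigroup using (x∙yz≈y∙xz)

  infixl 6 _-ε_

  _-ε_ : Vec ℕ (suc d) → Fin (suc d) → Vec ℕ (suc d)
  a -ε j = minusε j a

  -- ∂^(j)(a ⊗ b) = weight a_j b_j · (a − ε^(j)) ⊗ (b − ε^(j)): the case b_j = 0 of
  -- the definition needs no special treatment, the coefficient b_j vanishes there.
  weight : ℕ → ℕ → Carrier
  weight zero    _ = 0#
  weight (suc _) n = natK K n

  ⟦∂⟧ : ∀ j a b (h : Basis × Basis → Carrier) →
        ⟦ ∂ j (lift a , lift b) ⟧ h ≈ weight (lookup a j) (lookup b j) * h (lift (a -ε j) , lift (b -ε j))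
  ⟦∂⟧ j a b h with lookup a j | lookup b j
  ... | zero  | _     = sym (zeroˡ _)
  ... | suc _ | zero  = sym (zeroˡ _)
  ... | suc _ | suc _ = +-identityʳ _

  ⟦∂₁₃∘∂₂₃⟧ : ∀ i j a a′ b h → ⟦ ∂ i ₁₃∘ ∂ j ₂₃⟧ (lift a , lift a′ , lift b) h ≈
              weight (lookup a′ j) (lookup b j) * (weight (lookup a i) (lookup (b -ε j) i) *
                h (lift (a -ε i) , lift (a′ -ε j) , lift (b -ε j -ε i)))
  ⟦∂₁₃∘∂₂₃⟧ i j a a′ b h = trans (⟦∂⟧ j a′ b _) (*-congˡ (⟦∂⟧ i a (b -ε j) _))

  weight-exchange : ∀ x z y (t : Carrier) →
                    weight x y * (weight z (pred y) * t) ≈ weight z y * (weight x (pred y) * t)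
  weight-exchange zero    z       y t = trans (zeroˡ _) (sym (trans (*-congˡ (zeroˡ t)) (zeroʳ _)))
  weight-exchange (suc _) zero    y t = trans (*-congˡ (zeroˡ t)) (trans (zeroʳ _) (sym (zeroˡ _)))
  weight-exchange (suc _) (suc _) y t = refl

  ∂-commute₁₃₂₃ : ∀ i j → Commute₁₃₂₃ (∂ i) (∂ j)
  ∂-commute₁₃₂₃ i j (lift a , lift a′ , lift b) h with i ≟ j
  ... | yes ≡.refl = begin
    ⟦ ∂ i ₁₃∘ ∂ i ₂₃⟧ (lift a , lift a′ , lift b) h
      ≈⟨ ⟦∂₁₃∘∂₂₃⟧ i i a a′ b h ⟩
    weight (lookup a′ i) bᵢ * (weight (lookup a i) (lookup (b -ε i) i) * t)
      ≡⟨ ≡.cong (λ n → weight (lookup a′ i) bᵢ * (weight (lookup a i) n * t)) (lookup∘updateAt i b) ⟩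
    weight (lookup a′ i) bᵢ * (weight (lookup a i) (pred bᵢ) * t)
      ≈⟨ weight-exchange (lookup a′ i) (lookup a i) bᵢ t ⟩
    weight (lookup a i) bᵢ * (weight (lookup a′ i) (pred bᵢ) * t)
      ≡⟨ ≡.cong (λ n → weight (lookup a i) bᵢ * (weight (lookup a′ i) n * t)) (lookup∘updateAt i b) ⟨
    weight (lookup a i) bᵢ * (weight (lookup a′ i) (lookup (b -ε i) i) * t)
      ≈⟨ ⟦∂₁₃∘∂₂₃⟧ i i a′ a b _ ⟨
    ⟦ ∂ i ₁₃∘ ∂ i ₂₃⟧ (lift a′ , lift a , lift b) (λ y → h (swap₁₂ y)) ∎
    where
    bᵢ : ℕ
    bᵢ = lookup b i
    t : Carrier
    t = h (lift (a -ε i) , lift (a′ -ε i) , lift (b -ε i -ε i))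
  ... | no i≢j = begin
    ⟦ ∂ i ₁₃∘ ∂ j ₂₃⟧ (lift a , lift a′ , lift b) h
      ≈⟨ ⟦∂₁₃∘∂₂₃⟧ i j a a′ b h ⟩
    weight (lookup a′ j) (lookup b j) * (weight (lookup a i) (lookup (b -ε j) i) * t (b -ε j -ε i))
      ≡⟨ ≡.cong₂ (λ n b′ → weight (lookup a′ j) (lookup b j) * (weight (lookup a i) n * t b′))
                 (lookup∘updateAt′ i j i≢j b) (updateAt-commutes i j i≢j b) ⟩
    weight (lookup a′ j) (lookup b j) * (weight (lookup a i) (lookup b i) * t (b -ε i -ε j))
      ≈⟨ x∙yz≈y∙xz _ _ _ ⟩
    weight (lookup a i) (lookup b i) * (weight (lookup a′ j) (lookup b j) * t (b -ε i -ε j))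
      ≡⟨ ≡.cong (λ n → weight (lookup a i) (lookup b i) * (weight (lookup a′ j) n * t (b -ε i -ε j)))
                (lookup∘updateAt′ j i (λ j≡i → i≢j (≡.sym j≡i)) b) ⟨
    weight (lookup a i) (lookup b i) * (weight (lookup a′ j) (lookup (b -ε i) j) * t (b -ε i -ε j))
      ≈⟨ ⟦∂₁₃∘∂₂₃⟧ j i a′ a b _ ⟨
    ⟦ ∂ j ₁₃∘ ∂ i ₂₃⟧ (lift a′ , lift a , lift b) (λ y → h (swap₁₂ y)) ∎
    where
    t : Vec ℕ (suc d) → Carrier
    t b′ = h (lift (a -ε i) , lift (a′ -ε j) , lift b′)

proposition4p3 : ∀ {c ℓ : Level} (K : Field c ℓ) → CharacteristicZero K →
    (d : ℕ) (λs : Fin (suc d) → Field.Carrier K) →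
    FreeVect.TreeCompatible K (Derivations._≟B_ K d) (Derivations._≟B_ K d)
      (Derivations.∂λ K d λs)
proposition4p3 K _ d λs =
  treeCompatible _≟B_ _≟B_
    (commute₁₃₂₃-linCombˡ indices λs ∂ (∂λ λs) λ i →
      commute₁₃₂₃-linCombʳ indices λs (∂ i) ∂ (∂-commute₁₃₂₃ i))
  where
  open Derivations K d
  open TreeCompatibility K
  open DerivationsCommute K d
  indices : List (Fin (suc d))
  indices = toList (allFin (suc d))
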